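{- Let $p,q\in P$ with $p\neq q$ and $a\in\Sigma$. Let $(M,\gamma)$ be an MSC over $P$ and $\Sigma\times\{0,1\}$, with $M=(E,\to,\lhd,\lambda)\in\mathrm{MSC}(P,\Sigma)$ and $\gamma:E\to\{0,1\}$. The following are equivalent: (1) for every $e\in E_p$ with $\gamma(e)=0$, there is no $f\in E$ with $\lambda(f)=(q,a)$ and $e\parallel f$; (2) there is a path $\pi$ in the directed graph $(E,\to\cup\lhd)$ such that all events $e\in E_p$ with $\gamma(e)=0$ and all events $f$ with $\lambda(f)=(q,a)$ lie on $\pi$.
   Context: Fix a finite set $P$ of processes and a finite alphabet $\Sigma$. A message sequence chart (MSC) over $P$ and $\Sigma$ is $M=((w_p)_{p\in P},\lhd)$ with $w_p\in\Sigma^*$, at least one nonempty; events $E=\bigcup_pE_p$, $E_p=\{p\}\times\{1,\dots,|w_p|\}$; process relation $(p,i)\to(p,i+1)$; labelling $\lambda(p,i)=(p,a)$ with $a$ the $i$-th letter of $w_p$; message relation $\lhd\subseteq\bigcup_{p\ne q}E_p\times E_q$ with $\to\cup\lhd$ acyclic, each event in at most one $\lhd$-pair, and FIFO: for $(e,f),(e',f')\in\lhd\cap(E_p\times E_q)$, $e\to^*e'$ iff $f\to^*f'$. We write $M=(E,\to,\lhd,\lambda)$. Let $\le=(\to\cup\lhd)^*$ and $e\parallel f$ iff neither $e\le f$ nor $f\le e$. An MSC over $P$ and $\Sigma\times\{0,1\}$ is identified with a pair $(M,\gamma)$, $M\in\mathrm{MSC}(P,\Sigma)$, $\gamma:E\to\{0,1\}$.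 A path is a finite sequence of events $g_1,\dots,g_n$ with $(g_i,g_{i+1})\in\to\cup\lhd$ for all $i$. -}

module Defs where

open import Data.Nat using (ℕ)
open import Data.Fin using (Fin; toℕ)
open import Data.List using (List; []; length; lookup)
open import Data.Bool using (Bool; true)
open import Data.Product using (Σ; ∃; _×_; _,_; proj₁; proj₂)
open import Data.Sum using (_⊎_)
open import Relation.Binary.PropositionalEquality using (_≡_; _≢_)
open import Relation.Nullary using (¬_)
open import Relation.Binary.Construct.Closure.ReflexiveTransitive using (Star)
open import Relation.Binary.Construct.Closure.Transitive using (TransClosure)
open import Data.List.Relation.Unary.Linked using (Linked)
open import Data.List.Membership.Propositional using (_∈_)
open import Function.Bundles using (_⇔_)

-- Processes P = Fin np, alphabet Σ = Fin ns (both finite).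
-- A word per process.
Words : ℕ → ℕ → Set
Words np ns = Fin np → List (Fin ns)

-- Events (p , i), with i a 0-based position in w_p (the paper's i+1).
Ev : ∀ {np ns} → Words np ns → Set
Ev {np} w = Σ (Fin np) (λ p → Fin (length (w p)))

data ProcStep {np ns} (w : Words np ns) : Ev w → Ev w → Set where
  step : ∀ p (i j : Fin (length (w p))) → toℕ j ≡ Data.Nat.suc (toℕ i) →
         ProcStep w (p , i) (p , j)

label : ∀ {np ns} (w : Words np ns) → Ev w → Fin np × Fin ns
label w (p , i) = p , lookup (w p) i

MsgRel : ∀ {np ns} → Words np ns → Set
MsgRel w = Ev w → Ev w → Bool

Msg : ∀ {np ns} (w : Words np ns) → MsgRel w → Ev w → Ev w → Set
Msg w m e f = m e f ≡ true

data Edge {np ns} (w : Words np ns) (m : MsgRel w) : Ev w → Ev w → Set where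
  proc : ∀ {e f} → ProcStep w e f → Edge w m e f
  msg  : ∀ {e f} → Msg w m e f → Edge w m e f

record MSC (np ns : ℕ) : Set where
  field
    w        : Words np ns
    nonempty : ∃ λ p → w p ≢ []
    m        : MsgRel w
    msgProc  : ∀ (e f : Ev w) → Msg w m e f → proj₁ e ≢ proj₁ f
    acyclic  : ∀ (e : Ev w) → ¬ TransClosure (Edge w m) e e
    -- each event is in at most one ◁-pair
    atMostOne : ∀ (e f g h : Ev w) → Msg w m e f → Msg w m g h →
                (e ≡ g ⊎ e ≡ h ⊎ f ≡ g ⊎ f ≡ h) → (e ≡ g × f ≡ h)
    fifo     : ∀ (e f e′ f′ : Ev w) → Msg w m e f → Msg w m e′ f′ →
               proj₁ e ≡ proj₁ e′ → proj₁ f ≡ proj₁ f′ →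
               (Star (ProcStep w) e e′ ⇔ Star (ProcStep w) f f′)

module _ {np ns : ℕ} (M : MSC np ns) where
  open MSC M

  Event : Set
  Event = Ev w

  _≤ᴹ_ : Event → Event → Set
  e ≤ᴹ f = Star (Edge w m) e f

  _∥_ : Event → Event → Set
  e ∥ f = ¬ (e ≤ᴹ f) × ¬ (f ≤ᴹ e)

  IsPath : List Event → Set
  IsPath π = π ≢ [] × Linked (Edge w m) π

  λᴹ : Event → Fin np × Fin ns
  λᴹ = label w

-- If every p-event with γ = 0 is comparable with every (q,a)-event, then the set
-- of these "marked" events is totally ordered by ≤: two marked events on the same
-- process are ordered by the process order, and the remaining pairs are not
-- concurrent by assumption. Since → ∪ ◁ is a finite acyclic graph with decidable
-- edges, ≤ is a decidable partial order, so the marked events can be sorted into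
-- a ≤-chain, and each ≤-step of the chain unfolds into a sequence of edges. The
-- converse holds because any two events on a path are comparable.
module Submission where

open import Defs
open import Data.Nat using (ℕ; suc; _≤_; _<_; _≤′_; ≤′-refl; ≤′-step) renaming (_≟_ to _≟ⁿ_)
open import Data.Nat.Properties using (≤-total; ≤⇒≤′; <-trans; n<1+n)
open import Data.Fin using (Fin; zero; toℕ; fromℕ<)
open import Data.Fin.Properties using (toℕ<n; toℕ-fromℕ<; fromℕ<-toℕ) renaming (_≟_ to _≟ᶠ_)
open import Data.Product using (Σ; ∃; _×_; _,_; proj₁; proj₂)
open import Data.Product.Properties using (≡-dec)
open import Data.Sum using (_⊎_; inj₁; inj₂; [_,_]′)
import Data.Sum as Sum
open import Data.List using (List; []; _∷_; length; map; concatMap; allFin)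
open import Data.List.Membership.Propositional using (_∈_; _∉_)
open import Data.List.Membership.Propositional.Properties using (∈-map⁺; ∈-allFin; ∈-concatMap⁺)
open import Data.List.Relation.Binary.Subset.Propositional using (_⊆_)
open import Data.List.Relation.Binary.Permutation.Propositional using (↭-sym)
import Data.List.Relation.Binary.Permutation.Propositional.Properties as ↭
open import Data.List.Relation.Unary.Any using (here; there)
import Data.List.Relation.Unary.Any as Any
open import Data.List.Relation.Unary.Linked using (Linked; []; [-]; _∷_)
import Data.List.Relation.Unary.Linked.Properties as Linked
import Data.List.Membership.DecPropositional as DecMembership
open import Data.Bool.Properties using () renaming (_≟_ to _≟ᵇ_)
open import Data.Empty using (⊥-elim)
open import Function using (_∘_; id)
open import Function.Bundles using (_⇔_; mk⇔)
open import Relation.Binary.Core using (Rel)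
open import Relation.Binary.Bundles using (DecTotalOrder)
open import Relation.Binary.Structures using (IsDecPartialOrder)
open import Relation.Binary.Definitions using (Decidable; DecidableEquality; Antisymmetric)
import Relation.Binary.Construct.On as On
open import Relation.Binary.PropositionalEquality using (_≡_; _≢_; refl; sym; trans; cong; subst)
open import Relation.Binary.Construct.Closure.ReflexiveTransitive using (Star; ε; _◅_; _◅◅_)
import Relation.Binary.Construct.Closure.ReflexiveTransitive.Properties as Star
open import Relation.Binary.Construct.Closure.Transitive using (TransClosure; [_]; _∷_; _++_)
open import Relation.Nullary using (¬_; yes; no; contradiction)
open import Relation.Nullary.Decidable using (map′; _⊎-dec_; _×-dec_)
open import Relation.Unary using (Pred)
import Relation.Unary as U

⊆-∷-drop : ∀ {a} {A : Set a} {y : A} {xs ys} → y ∉ xs → xs ⊆ y ∷ ys → xs ⊆ ys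
⊆-∷-drop y∉xs xs⊆y∷ys x∈xs with xs⊆y∷ys x∈xs
... | here refl = contradiction x∈xs y∉xs
... | there x∈ys = x∈ys

first-index : ∀ {a} {A : Set a} {xs : List A} → xs ≢ [] → Fin (length xs)
first-index {xs = []} []≢[] = contradiction refl []≢[]
first-index {xs = _ ∷ _} _ = zero

module _ {a ℓ} {A : Set a} {R : Rel A ℓ} where

  _◅⁺_ : ∀ {x y z} → R x y → Star R y z → TransClosure R x z
  r ◅⁺ ε = [ r ]
  r ◅⁺ (r′ ◅ s) = r ∷ (r′ ◅⁺ s)

  ⁺⇒⋆ : ∀ {x y} → TransClosure R x y → Star R x y
  ⁺⇒⋆ [ r ] = r ◅ ε
  ⁺⇒⋆ (r ∷ t) = r ◅ ⁺⇒⋆ t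

  Linked-comparable : ∀ {xs x y} → Linked R xs → x ∈ xs → y ∈ xs →
                      Star R x y ⊎ Star R y x
  Linked-comparable l (here refl) y∈ = inj₁ (reach l y∈)
    where
    reach : ∀ {x xs y} → Linked R (x ∷ xs) → y ∈ x ∷ xs → Star R x y
    reach l (here refl) = ε
    reach (r ∷ l) (there y∈) = r ◅ reach l y∈
  Linked-comparable l (there x∈) (here refl) = [ inj₂ , inj₁ ]′ (Linked-comparable l (here refl) (there x∈))
  Linked-comparable [-] (there ()) (there _)
  Linked-comparable (_ ∷ l) (there x∈) (there y∈) = Linked-comparable l x∈ y∈

  star-prepend : ∀ {x y} → Star R x y → List A → List A
  star-prepend ε rs = rs
  star-prepend (_◅_ {j = z} _ s) rs = z ∷ star-prepend s rs

  star-prepend-linked : ∀ {x y rs} (s : Star R x y) →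
                        Linked R (y ∷ rs) → Linked R (x ∷ star-prepend s rs)
  star-prepend-linked ε l = l
  star-prepend-linked (r ◅ s) l = r ∷ star-prepend-linked s l

  star-prepend-⊇ : ∀ {x y rs} (s : Star R x y) → y ∷ rs ⊆ x ∷ star-prepend s rs
  star-prepend-⊇ ε = id
  star-prepend-⊇ (_ ◅ s) = there ∘ star-prepend-⊇ s

  Linked-⋆⇒path : ∀ {x xs} → Linked (Star R) (x ∷ xs) →
                  ∃ λ ys → Linked R (x ∷ ys) × x ∷ xs ⊆ x ∷ ys
  Linked-⋆⇒path [-] = [] , [-] , id
  Linked-⋆⇒path (s ∷ l) with ys , l′ , ⊆ys ← Linked-⋆⇒path l =
    star-prepend s ys , star-prepend-linked s l′ ,
    λ { (here refl) → here refl ; (there z∈) → star-prepend-⊇ s (⊆ys z∈) }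

module FiniteAcyclic
  {a ℓ} {A : Set a} {R : Rel A ℓ}
  (_≟_ : DecidableEquality A) (R? : Decidable R)
  {vertices : List A} (∈-vertices : ∀ x → x ∈ vertices)
  (acyclic : ∀ x → ¬ TransClosure R x x)
  where

  open DecMembership _≟_ using (_∈?_)

  private
    _⁺_ : Rel A _
    _⁺_ = TransClosure R

  interior : ∀ {x y} → x ⁺ y → List A
  interior [ _ ] = []
  interior (_∷_ {y = z} _ t) = z ∷ interior t

  split-at : ∀ {x y z} (t : x ⁺ z) → y ∈ interior t →
             Σ (x ⁺ y) λ t₁ → Σ (y ⁺ z) λ t₂ →
               interior t₁ ⊆ interior t × interior t₂ ⊆ interior t
  split-at (r ∷ t) (here refl) = [ r ] , t , (λ ()) , there
  split-at (r ∷ t) (there y∈) with t₁ , t₂ , ⊆₁ , ⊆₂ ← split-at t y∈ =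
    r ∷ t₁ , t₂ , (λ { (here refl) → here refl ; (there z∈) → there (⊆₁ z∈) }) , there ∘ ⊆₂

  source∉interior : ∀ {x y} (t : x ⁺ y) → x ∉ interior t
  source∉interior t x∈ = acyclic _ (proj₁ (split-at t x∈))

  target∉interior : ∀ {x y} (t : x ⁺ y) → y ∉ interior t
  target∉interior t y∈ = acyclic _ (proj₁ (proj₂ (split-at t y∈)))

  -- Floyd–Warshall: Via U x y holds iff some R⁺-path from x to y has all its
  -- interior vertices in U; by acyclicity such a path visits each vertex once.
  Via : List A → Rel A ℓ
  Via [] = R
  Via (v ∷ U) x y = Via U x y ⊎ (Via U x v × Via U v y)

  via? : ∀ U → Decidable (Via U)
  via? [] = R?
  via? (v ∷ U) x y = via? U x y ⊎-dec (via? U x v ×-dec via? U v y)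

  via⇒⁺ : ∀ U {x y} → Via U x y → x ⁺ y
  via⇒⁺ [] r = [ r ]
  via⇒⁺ (v ∷ U) (inj₁ t) = via⇒⁺ U t
  via⇒⁺ (v ∷ U) (inj₂ (t₁ , t₂)) = via⇒⁺ U t₁ ++ via⇒⁺ U t₂

  ⁺⇒via : ∀ U {x y} (t : x ⁺ y) → interior t ⊆ U → Via U x y
  ⁺⇒via [] [ r ] _ = r
  ⁺⇒via [] (_ ∷ _) ⊆[] with () ← ⊆[] (here refl)
  ⁺⇒via (v ∷ U) t ⊆v∷U with v ∈? interior t
  ... | no v∉ = inj₁ (⁺⇒via U t (⊆-∷-drop v∉ ⊆v∷U))
  ... | yes v∈ with t₁ , t₂ , ⊆₁ , ⊆₂ ← split-at t v∈ =
    inj₂ ( ⁺⇒via U t₁ (⊆-∷-drop (target∉interior t₁) (⊆v∷U ∘ ⊆₁))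
         , ⁺⇒via U t₂ (⊆-∷-drop (source∉interior t₂) (⊆v∷U ∘ ⊆₂)))

  ⁺? : Decidable _⁺_
  ⁺? x y = map′ (via⇒⁺ vertices) (λ t → ⁺⇒via vertices t (λ {z} _ → ∈-vertices z))
                (via? vertices x y)

  ⋆? : Decidable (Star R)
  ⋆? x y with x ≟ y | ⁺? x y
  ... | yes refl | _ = yes ε
  ... | no _ | yes t = yes (⁺⇒⋆ t)
  ... | no x≢y | no ¬t = no λ { ε → x≢y refl ; (r ◅ s) → ¬t (r ◅⁺ s) }

  ⋆-antisym : Antisymmetric _≡_ (Star R)
  ⋆-antisym ε _ = refl
  ⋆-antisym (r ◅ s) t = ⊥-elim (acyclic _ (r ◅⁺ (s ◅◅ t)))

  ⋆-isDecPartialOrder : IsDecPartialOrder _≡_ (Star R)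
  ⋆-isDecPartialOrder = record
    { isPartialOrder = record { isPreorder = Star.isPreorder R ; antisym = ⋆-antisym }
    ; _≟_ = _≟_
    ; _≤?_ = ⋆?
    }

module Chain
  {a ℓ p} {A : Set a} {_≤_ : Rel A ℓ}
  (isDecPartialOrder : IsDecPartialOrder _≡_ _≤_)
  {P : Pred A p} (P? : U.Decidable P)
  (total-on-P : ∀ {x y} → P x → P y → x ≤ y ⊎ y ≤ x)
  where

  restrict : List A → List (Σ A P)
  restrict [] = []
  restrict (x ∷ xs) with P? x
  ... | yes px = (x , px) ∷ restrict xs
  ... | no _ = restrict xs

  ∈-restrict : ∀ {x xs} → x ∈ xs → P x → x ∈ map proj₁ (restrict xs)
  ∈-restrict {xs = y ∷ ys} x∈ px with P? y | x∈
  ... | yes _ | here refl = here refl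
  ... | yes _ | there x∈ys = there (∈-restrict x∈ys px)
  ... | no ¬py | here refl = contradiction px ¬py
  ... | no _ | there x∈ys = ∈-restrict x∈ys px

  restricted-decTotalOrder : DecTotalOrder _ _ _
  restricted-decTotalOrder = record
    { Carrier = Σ A P
    ; isDecTotalOrder = record
      { isTotalOrder = record
        { isPartialOrder = On.isPartialOrder proj₁ isPartialOrder
        ; total = λ x y → total-on-P (proj₂ x) (proj₂ y)
        }
      ; _≟_ = On.decidable proj₁ _≡_ _≟_
      ; _≤?_ = On.decidable proj₁ _≤_ _≤?_
      }
    }
    where open IsDecPartialOrder isDecPartialOrder

  open import Data.List.Sort restricted-decTotalOrder using (sort; sort-↭; sort-↗)

  chain-through : ∀ xs → ∃ λ ys → Linked _≤_ ys × (∀ {x} → x ∈ xs → P x → x ∈ ys)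
  chain-through xs =
    map proj₁ (sort S) ,
    Linked.map⁺ (sort-↗ S) ,
    λ x∈ px → ↭.∈-resp-↭ (↭-sym (↭.map⁺ proj₁ (sort-↭ S))) (∈-restrict x∈ px)
    where S = restrict xs

module _ {np ns : ℕ} (M : MSC np ns) where
  open MSC M

  private
    _≟ᴱ_ : DecidableEquality (Event M)
    _≟ᴱ_ = ≡-dec _≟ᶠ_ _≟ᶠ_

    _≼_ : Rel (Event M) _
    _≼_ = _≤ᴹ_ M

  edge? : Decidable (Edge w m)
  edge? e f with m e f ≟ᵇ _
  ... | yes e◁f = yes (msg e◁f)
  edge? (p , i) (p′ , j) | no ¬e◁f with p ≟ᶠ p′
  ... | no p≢p′ = no λ { (proc (step _ _ _ _)) → p≢p′ refl ; (msg e◁f) → ¬e◁f e◁f }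
  ... | yes refl with toℕ j ≟ⁿ suc (toℕ i)
  ...   | yes j≡1+i = yes (proc (step p i j j≡1+i))
  ...   | no j≢1+i = no λ { (proc (step _ _ _ j≡1+i)) → j≢1+i j≡1+i ; (msg e◁f) → ¬e◁f e◁f }

  events : List (Event M)
  events = concatMap (λ p → map (p ,_) (allFin _)) (allFin np)

  ∈-events : ∀ e → e ∈ events
  ∈-events (p , i) =
    ∈-concatMap⁺ (λ p → map (p ,_) (allFin _)) (Any.map (λ { refl → ∈-map⁺ (p ,_) (∈-allFin i) }) (∈-allFin p))

  open FiniteAcyclic _≟ᴱ_ edge? ∈-events acyclic using (⋆?; ⋆-isDecPartialOrder)

  process-ordered : ∀ p {i j : Fin _} → toℕ i ≤ toℕ j → (p , i) ≼ (p , j)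
  process-ordered p {i} {j} i≤j =
    subst ((p , i) ≼_) (cong (p ,_) (fromℕ<-toℕ j (toℕ<n j))) (ascend (toℕ<n j) (≤⇒≤′ i≤j))
    where
    ascend : ∀ {n} (n<∣wₚ∣ : n < _) → toℕ i ≤′ n → (p , i) ≼ (p , fromℕ< n<∣wₚ∣)
    ascend n<∣wₚ∣ ≤′-refl = subst ((p , i) ≼_) (cong (p ,_) (sym (fromℕ<-toℕ i n<∣wₚ∣))) ε
    ascend {suc n} 1+n<∣wₚ∣ (≤′-step i≤n) = ascend n<∣wₚ∣ i≤n ◅◅ (proc (step p _ _ toℕ-next) ◅ ε)
      where
      n<∣wₚ∣ = <-trans (n<1+n n) 1+n<∣wₚ∣
      toℕ-next = trans (toℕ-fromℕ< 1+n<∣wₚ∣) (cong suc (sym (toℕ-fromℕ< n<∣wₚ∣)))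

  same-process-comparable : ∀ {e f} → proj₁ e ≡ proj₁ f → e ≼ f ⊎ f ≼ e
  same-process-comparable {p , i} {.p , j} refl =
    Sum.map (process-ordered p) (process-ordered p) (≤-total (toℕ i) (toℕ j))

  non-concurrent⇒comparable : ∀ {e f} → ¬ _∥_ M e f → e ≼ f ⊎ f ≼ e
  non-concurrent⇒comparable {e} {f} ¬e∥f with ⋆? e f | ⋆? f e
  ... | yes e≤f | _ = inj₁ e≤f
  ... | no _ | yes f≤e = inj₂ f≤e
  ... | no e≰f | no f≰e = contradiction (e≰f , f≰e) ¬e∥f

  some-event : Event M
  some-event = proj₁ nonempty , first-index (proj₂ nonempty)

  path-through : ∀ {ℓ} {P : Pred (Event M) ℓ} → U.Decidable P →
                 (∀ {e f} → P e → P f → e ≼ f ⊎ f ≼ e) →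
                 Σ (List (Event M)) λ π → IsPath M π × (∀ {e} → P e → e ∈ π)
  path-through P? comparable with Chain.chain-through ⋆-isDecPartialOrder P? comparable events
  ... | [] , _ , ⊆chain = some-event ∷ [] , ((λ ()) , [-]) , λ Pe → contradiction (⊆chain (∈-events _) Pe) λ ()
  ... | x ∷ xs , chain , ⊆chain with ys , path , ⊆path ← Linked-⋆⇒path chain =
    x ∷ ys , ((λ ()) , path) , λ Pe → ⊆path (⊆chain (∈-events _) Pe)

lemma16 : ∀ {np ns : ℕ} (p q : Fin np) → p ≢ q → (a : Fin ns) →
          (M : MSC np ns) → (γ : Event M → Fin 2) →
          ((∀ (e : Event M) → proj₁ e ≡ p → γ e ≡ zero →
             ¬ (Σ (Event M) λ f → λᴹ M f ≡ (q , a) × _∥_ M e f))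
           ⇔
           (Σ (List (Event M)) λ π → IsPath M π ×
             (∀ (e : Event M) → proj₁ e ≡ p → γ e ≡ zero → e ∈ π) ×
             (∀ (f : Event M) → λᴹ M f ≡ (q , a) → f ∈ π)))
lemma16 p q _ a M γ = mk⇔ no-concurrency⇒path path⇒no-concurrency
  where
  NoConcurrency : Set
  NoConcurrency = ∀ (e : Event M) → proj₁ e ≡ p → γ e ≡ zero →
                  ¬ (Σ (Event M) λ f → λᴹ M f ≡ (q , a) × _∥_ M e f)

  PathThroughMarked : Set
  PathThroughMarked = Σ (List (Event M)) λ π → IsPath M π ×
                        (∀ (e : Event M) → proj₁ e ≡ p → γ e ≡ zero → e ∈ π) ×
                        (∀ (f : Event M) → λᴹ M f ≡ (q , a) → f ∈ π)

  Marked : Pred (Event M) _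
  Marked e = (proj₁ e ≡ p × γ e ≡ zero) ⊎ λᴹ M e ≡ (q , a)

  marked? : U.Decidable Marked
  marked? e = ((proj₁ e ≟ᶠ p) ×-dec (γ e ≟ᶠ zero)) ⊎-dec ≡-dec _≟ᶠ_ _≟ᶠ_ (λᴹ M e) (q , a)

  marked-comparable : NoConcurrency → ∀ {e f} → Marked e → Marked f → _≤ᴹ_ M e f ⊎ _≤ᴹ_ M f e
  marked-comparable _ (inj₁ (refl , _)) (inj₁ (f≡p , _)) = same-process-comparable M (sym f≡p)
  marked-comparable _ (inj₂ eλ) (inj₂ fλ) = same-process-comparable M (trans (cong proj₁ eλ) (sym (cong proj₁ fλ)))
  marked-comparable no-conc (inj₁ (ep , eγ)) (inj₂ fλ) =
    non-concurrent⇒comparable M λ e∥f → no-conc _ ep eγ (_ , fλ , e∥f)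
  marked-comparable no-conc (inj₂ eλ) (inj₁ (fp , fγ)) =
    non-concurrent⇒comparable M λ (e≰f , f≰e) → no-conc _ fp fγ (_ , eλ , f≰e , e≰f)

  no-concurrency⇒path : NoConcurrency → PathThroughMarked
  no-concurrency⇒path no-conc with π , path , ⊆π ← path-through M marked? (marked-comparable no-conc) =
    π , path , (λ e ep eγ → ⊆π (inj₁ (ep , eγ))) , λ f fλ → ⊆π (inj₂ fλ)

  path⇒no-concurrency : PathThroughMarked → NoConcurrency
  path⇒no-concurrency (π , (_ , linked) , p-on , qa-on) e ep eγ (f , fλ , e≰f , f≰e) =
    [ e≰f , f≰e ]′ (Linked-comparable linked (p-on e ep eγ) (qa-on f fλ))
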